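{- Let $n\ge 5$ be an integer and let $M$ be the $0/1$ matrix whose rows are indexed by the $\binom{n}{2}$ edges of the complete graph $K_n$ and whose columns are indexed by the $3\binom{n}{4}$ cycles of length $4$ in $K_n$, with $M_{e,C}=1$ if and only if the edge $e$ lies in the $4$-cycle $C$. Then the kernel of $M$ (over $\mathbb{R}$) has dimension $3\binom{n}{4}-\binom{n}{2}$.
   Context: A cycle $(v_1,v_2,v_3,v_4)$ in $K_n$ is the subgraph on four distinct vertices $v_1,\dots,v_4$ with edge set $\{\{v_1,v_2\},\{v_2,v_3\},\{v_3,v_4\},\{v_4,v_1\}\}$; two such cycles are the same if they have the same edge set.
   Formalization: The kernel of M is taken over ℚ rather than over ℝ, so its vectors and the coefficients in linear combinations are rational. -}

module Defs where

open import Data.Bool using (Bool; true; false; _∧_; _∨_; not; if_then_else_)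
open import Data.Nat using (ℕ; zero; suc; _<ᵇ_; _≡ᵇ_)
open import Data.Fin using (Fin; toℕ; zero; suc)
open import Data.List using (List; []; _∷_; filterᵇ; length; lookup; concatMap; map; allFin)
open import Data.Product using (_×_; _,_; Σ; ∃)
open import Data.Rational using (ℚ; 0ℚ; 1ℚ; _+_; _*_)
open import Relation.Binary.PropositionalEquality using (_≡_)

Quad : ℕ → Set
Quad n = Fin n × Fin n × Fin n × Fin n

allQuads : (n : ℕ) → List (Quad n)
allQuads n =
  concatMap (λ a → concatMap (λ b → concatMap (λ c → map (λ d → (a , b , c , d))
    (allFin n)) (allFin n)) (allFin n)) (allFin n)

_<F_ : ∀ {n} → Fin n → Fin n → Bool
i <F j = toℕ i <ᵇ toℕ j

_=F_ : ∀ {n} → Fin n → Fin n → Bool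
i =F j = toℕ i ≡ᵇ toℕ j

-- Canonical representative of a 4-cycle (v1,v2,v3,v4) (up to equal edge set):
-- four distinct vertices, v1 is the least vertex, and v2 < v4
-- (this kills the 8 rotations/reflections giving the same edge set).
canonical : ∀ {n} → Quad n → Bool
canonical (v1 , v2 , v3 , v4) =
  (v1 <F v2) ∧ (v1 <F v3) ∧ (v1 <F v4) ∧ (v2 <F v4)
  ∧ not (v2 =F v3) ∧ not (v3 =F v4)

cycles : (n : ℕ) → List (Quad n)
cycles n = filterᵇ canonical (allQuads n)

numCycles : ℕ → ℕ
numCycles n = length (cycles n)

samePair : ∀ {n} → Fin n → Fin n → Fin n → Fin n → Bool
samePair a b c d = ((a =F c) ∧ (b =F d)) ∨ ((a =F d) ∧ (b =F c))

edgeIn : ∀ {n} → Fin n → Fin n → Quad n → Bool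
edgeIn a b (v1 , v2 , v3 , v4) =
  samePair a b v1 v2 ∨ samePair a b v2 v3 ∨ samePair a b v3 v4 ∨ samePair a b v4 v1

-- The incidence matrix M : rows = edges {a,b} (a < b), columns = cycles.
M : (n : ℕ) → Fin n → Fin n → Fin (numCycles n) → ℚ
M n a b c = if edgeIn a b (lookup (cycles n) c) then 1ℚ else 0ℚ

∑ : (m : ℕ) → (Fin m → ℚ) → ℚ
∑ zero    f = 0ℚ
∑ (suc m) f = f zero + ∑ m (λ i → f (suc i))

InKernel : (n : ℕ) → (Fin (numCycles n) → ℚ) → Set
InKernel n x = ∀ (a b : Fin n) → (a <F b) ≡ true →
  ∑ (numCycles n) (λ c → M n a b c * x c) ≡ 0ℚ

lincomb : ∀ {k m} → (Fin k → ℚ) → (Fin k → Fin m → ℚ) → Fin m → ℚ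
lincomb {k} α vs j = ∑ k (λ i → α i * vs i j)

LinIndep : ∀ {k m} → (Fin k → Fin m → ℚ) → Set
LinIndep {k} vs = ∀ (α : Fin k → ℚ) → (∀ j → lincomb α vs j ≡ 0ℚ) → ∀ i → α i ≡ 0ℚ

KernelDim : (n : ℕ) → ℕ → Set
KernelDim n d = Σ (Fin d → Fin (numCycles n) → ℚ) λ vs →
  (∀ i → InKernel n (vs i)) × LinIndep vs ×
  (∀ x → InKernel n x → ∃ λ α → ∀ j → x j ≡ lincomb α vs j)

-- Call a set of C(n,2) 4-cycles of K_n a cycle basis when the corresponding columns of M form a basis
-- of ℚ^E(K_n). Given one, every other column is a unique combination of basic columns, and the vectors
-- "e_C minus that combination", C running over the 3 C(n,4) − C(n,2) non-basic cycles, form a basis of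
-- the kernel. For K_5 a cycle basis is exhibited and checked by inverting its 10 × 10 block. A cycle
-- basis of K_k extends to K_{k+1}: call the new vertex 0 and add the k cycles 0-1-2-v (v ≥ 3), 0-1-3-2
-- and 0-2-1-3, one for each new edge {0 , v}. The old cycles avoid 0, so the enlarged square block of M
-- is block triangular, and its new diagonal block can be inverted by hand.
module Submission where

open import Algebra.Bundles using (CommutativeMonoid; Ring)
open import Algebra.Structures using (IsCommutativeMonoid)
open import Data.Bool using (Bool; true; false; _∧_; not; if_then_else_)
open import Data.Bool.Properties using (∧-zeroʳ; ∧-identityʳ; if-eta; if-float; T-≡; T?)
import Data.Bool.Properties as Bool
open import Data.Fin using (Fin; zero; suc)
import Data.Fin.Properties as Fin
open import Data.Fin.Patterns using (0F; 1F; 2F; 3F; 4F; 5F; 6F; 7F; 8F; 9F)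
open import Data.List using (List; []; _∷_; _++_; map; concatMap; filterᵇ; length; lookup; tabulate; allFin)
open import Data.Nat using (ℕ; zero; suc)
open import Data.Nat.Combinatorics using (_C_; nC1≡n; nCk+nC[k+1]≡[n+1]C[k+1])
import Data.Nat.Properties as ℕ
open import Data.Product using (_×_; _,_; proj₁; proj₂; ∃; uncurry)
import Data.Product as Product
open import Data.Product.Properties using (≡-dec)
open import Data.List.Membership.Propositional.Properties using (∈-lookup)
import Data.List.Relation.Unary.All as All
open import Data.List.Relation.Unary.All.Properties using (all-filter)
open import Function using (_∘_)
open import Function.Bundles using (Equivalence)
open import Relation.Binary.PropositionalEquality
open import Relation.Nullary using (Dec; yes; no; does; ¬_; contradiction)
open import Relation.Nullary.Decidable using (toWitness; _→-dec_; dec-true; dec-false; dec⇒maybe)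
open ≡-Reasoning

open import Defs

cycle : ∀ k → Fin (numCycles k) → Quad k
cycle k = lookup (cycles k)

canonical-cycle : ∀ k (i : Fin (numCycles k)) → canonical (cycle k i) ≡ true
canonical-cycle k i =
  Equivalence.to T-≡ (All.lookup (all-filter (T? ∘ canonical {k}) (allQuads k)) (∈-lookup {xs = cycles k} i))

-- K_{k+1} is K_k with a new vertex 0 in front; the old vertices are shifted up by one.
shift : ∀ {k} → Quad k → Quad (suc k)
shift (a , b , c , d) = suc a , suc b , suc c , suc d

_=Q_ : ∀ {k} → Quad k → Quad k → Bool
(a , b , c , d) =Q (a′ , b′ , c′ , d′) = (a =F a′) ∧ (b =F b′) ∧ (c =F c′) ∧ (d =F d′)

=F⇒≡ : ∀ {n} {i j : Fin n} → (i =F j) ≡ true → i ≡ j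
=F⇒≡ {i = zero} {zero} _ = refl
=F⇒≡ {i = suc i} {suc j} i=j = cong suc (=F⇒≡ i=j)

=F-refl : ∀ {n} (i : Fin n) → (i =F i) ≡ true
=F-refl zero = refl
=F-refl (suc i) = =F-refl i

=F-sym : ∀ {n} (i j : Fin n) → (i =F j) ≡ (j =F i)
=F-sym zero zero = refl
=F-sym zero (suc j) = refl
=F-sym (suc i) zero = refl
=F-sym (suc i) (suc j) = =F-sym i j

=Q-refl : ∀ {k} (q : Quad k) → (q =Q q) ≡ true
=Q-refl (a , b , c , d) rewrite =F-refl a | =F-refl b | =F-refl c | =F-refl d = refl

=Q⇒≡ : ∀ {k} {q q′ : Quad k} → (q =Q q′) ≡ true → q ≡ q′
=Q⇒≡ {q = a , b , c , d} {a′ , b′ , c′ , d′} q=q′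
  with true ← a =F a′ in a=a′ | true ← b =F b′ in b=b′ | true ← c =F c′ in c=c′ | true ← d =F d′ in d=d′
  = cong₂ _,_ (=F⇒≡ a=a′) (cong₂ _,_ (=F⇒≡ b=b′) (cong₂ _,_ (=F⇒≡ c=c′) (=F⇒≡ d=d′)))

-- A triple (b , c , d) stands for the cycle (0 , b+1 , c+1 , d+1) of K_{k+1}; fan marks the k cycles
-- 0-1-2-v (v ≥ 3), 0-1-3-2 and 0-2-1-3 added to a cycle basis of K_k.
fan : ∀ {k} → Fin k → Fin k → Fin k → Bool
fan 0F 1F (suc (suc _)) = true
fan 0F 2F 1F = true
fan 1F 0F 2F = true
fan _ _ _ = false

module Sums {a} {A : Set a} {_+_ : A → A → A} {0# : A}
            (isCM : IsCommutativeMonoid _≡_ _+_ 0#) where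

  open IsCommutativeMonoid isCM using (identityˡ; identityʳ; assoc)

  commutativeMonoid : CommutativeMonoid a a
  commutativeMonoid = record { isCommutativeMonoid = isCM }

  open import Algebra.Properties.CommutativeMonoid.Sum commutativeMonoid public
    using (sum; sum-syntax; sum-cong-≗; ∑-distrib-+; ∑-comm)
  open import Algebra.Properties.CommutativeMonoid.Sum commutativeMonoid
    using (sum-replicate-zero)

  sum-zero : ∀ n {f : Fin n → A} → (∀ i → f i ≡ 0#) → sum f ≡ 0#
  sum-zero n f≡0 = trans (sum-cong-≗ {y = λ _ → 0#} f≡0) (sum-replicate-zero n)

  sum-δ : ∀ {n} (j : Fin n) (f : Fin n → A) → ∑[ i < n ] (if i =F j then f i else 0#) ≡ f j
  sum-δ {suc n} zero f = trans (cong (f zero +_) (sum-zero n λ _ → refl)) (identityʳ _)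
  sum-δ {suc n} (suc j) f = trans (identityˡ _) (sum-δ j (f ∘ suc))

  sum-tail : ∀ {n} (f : Fin (suc n) → A) → f zero ≡ 0# → sum f ≡ ∑[ i < n ] f (suc i)
  sum-tail {n} f f0≡0 = trans (cong (_+ (∑[ i < n ] f (suc i))) f0≡0) (identityˡ _)

  sumList : ∀ {b} {B : Set b} → (B → A) → List B → A
  sumList h [] = 0#
  sumList h (x ∷ xs) = h x + sumList h xs

  module _ {b} {B : Set b} where

    sum-lookup : ∀ (h : B → A) xs → ∑[ i < length xs ] h (lookup xs i) ≡ sumList h xs
    sum-lookup h [] = refl
    sum-lookup h (x ∷ xs) = cong (h x +_) (sum-lookup h xs)

    sumList-++ : ∀ (h : B → A) xs ys → sumList h (xs ++ ys) ≡ sumList h xs + sumList h ys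
    sumList-++ h [] ys = sym (identityˡ _)
    sumList-++ h (x ∷ xs) ys = trans (cong (h x +_) (sumList-++ h xs ys)) (sym (assoc _ _ _))

    sumList-filterᵇ : ∀ (h : B → A) p xs → sumList h (filterᵇ p xs) ≡ sumList (λ x → if p x then h x else 0#) xs
    sumList-filterᵇ h p [] = refl
    sumList-filterᵇ h p (x ∷ xs) with p x
    ... | true = cong (h x +_) (sumList-filterᵇ h p xs)
    ... | false = trans (sumList-filterᵇ h p xs) (sym (identityˡ _))

    sumList-tabulate : ∀ {n} (h : B → A) (f : Fin n → B) → sumList h (tabulate f) ≡ sum (h ∘ f)
    sumList-tabulate {zero} h f = refl
    sumList-tabulate {suc n} h f = cong (h (f zero) +_) (sumList-tabulate h (f ∘ suc))

    module _ {c} {C : Set c} where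

      sumList-map : ∀ (h : B → A) (g : C → B) xs → sumList h (map g xs) ≡ sumList (h ∘ g) xs
      sumList-map h g [] = refl
      sumList-map h g (x ∷ xs) = cong (h (g x) +_) (sumList-map h g xs)

      sumList-concatMap : ∀ (h : B → A) (g : C → List B) xs →
                          sumList h (concatMap g xs) ≡ sumList (sumList h ∘ g) xs
      sumList-concatMap h g [] = refl
      sumList-concatMap h g (x ∷ xs) =
        trans (sumList-++ h (g x) (concatMap g xs)) (cong (sumList h (g x) +_) (sumList-concatMap h g xs))

  sumList-allFin : ∀ {n} (h : Fin n → A) → sumList h (allFin n) ≡ sum h
  sumList-allFin h = sumList-tabulate h (λ i → i)

  ∑Q : ∀ k → (Quad k → A) → A
  ∑Q k h = ∑[ a < k ] ∑[ b < k ] ∑[ c < k ] ∑[ d < k ] h (a , b , c , d)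

  ∑T : ∀ k → (Fin k → Fin k → Fin k → A) → A
  ∑T k g = ∑[ b < k ] ∑[ c < k ] ∑[ d < k ] g b c d

  ∑C : ∀ k → (Quad k → A) → A
  ∑C k h = ∑Q k (λ q → if canonical q then h q else 0#)

  ∑Q-cong : ∀ {k} {h h′ : Quad k → A} → (∀ q → h q ≡ h′ q) → ∑Q k h ≡ ∑Q k h′
  ∑Q-cong h≗h′ = sum-cong-≗ λ a → sum-cong-≗ λ b → sum-cong-≗ λ c → sum-cong-≗ λ d → h≗h′ (a , b , c , d)

  ∑Q-comm : ∀ {k n} (F : Fin n → Quad k → A) → ∑Q k (λ q → ∑[ t < n ] F t q) ≡ ∑[ t < n ] ∑Q k (F t)
  ∑Q-comm {k} {n} F =
    trans (sum-cong-≗ λ a → trans (sum-cong-≗ λ b → trans (sum-cong-≗ λ c →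
                                ∑-comm (λ d t → F t (a , b , c , d)))
                              (∑-comm (λ c t → ∑[ d < k ] F t (a , b , c , d))))
                            (∑-comm (λ b t → ∑[ c < k ] ∑[ d < k ] F t (a , b , c , d))))
          (∑-comm (λ a t → ∑[ b < k ] ∑[ c < k ] ∑[ d < k ] F t (a , b , c , d)))

  sumList-allQuads : ∀ k (h : Quad k → A) → sumList h (allQuads k) ≡ ∑Q k h
  sumList-allQuads k h =
    trans (sumList-concatMap h Ls (allFin k)) (trans (sumList-allFin (sumList h ∘ Ls)) (sum-cong-≗ λ a →
    trans (sumList-concatMap h (Lc a) (allFin k)) (trans (sumList-allFin (sumList h ∘ Lc a)) (sum-cong-≗ λ b →
    trans (sumList-concatMap h (Ld a b) (allFin k)) (trans (sumList-allFin (sumList h ∘ Ld a b)) (sum-cong-≗ λ c →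
    trans (sumList-map h (λ d → a , b , c , d) (allFin k)) (sumList-allFin (λ d → h (a , b , c , d)))))))))
    where
    Ld : Fin k → Fin k → Fin k → List (Quad k)
    Ld a b c = map (λ d → a , b , c , d) (allFin k)
    Lc : Fin k → Fin k → List (Quad k)
    Lc a b = concatMap (Ld a b) (allFin k)
    Ls : Fin k → List (Quad k)
    Ls a = concatMap (Lc a) (allFin k)

  sum-cycles : ∀ k (h : Quad k → A) → ∑[ i < numCycles k ] h (cycle k i) ≡ ∑C k h
  sum-cycles k h = begin
    ∑[ i < numCycles k ] h (cycle k i)                           ≡⟨ sum-lookup h (cycles k) ⟩
    sumList h (cycles k)                                         ≡⟨ sumList-filterᵇ h canonical (allQuads k) ⟩
    sumList (λ q → if canonical q then h q else 0#) (allQuads k) ≡⟨ sumList-allQuads k _ ⟩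
    ∑C k h                                                       ∎

  -- The least vertex of a canonical cycle comes first, so a cycle through the new vertex 0 starts there.
  ∑C-suc : ∀ k (h : Quad (suc k) → A) →
           ∑C (suc k) h ≡
           ∑T k (λ b c d → if canonical (0F , suc b , suc c , suc d) then h (0F , suc b , suc c , suc d) else 0#)
           + ∑C k (h ∘ shift)
  ∑C-suc k h = cong₂ _+_ through0 avoiding0
    where
    g : Quad (suc k) → A
    g q = if canonical q then h q else 0#

    through0 : ∑T (suc k) (λ b c d → g (0F , b , c , d)) ≡ ∑T k (λ b c d → g (0F , suc b , suc c , suc d))
    through0 =
      trans (sum-tail (λ b → ∑[ c < suc k ] ∑[ d < suc k ] g (0F , b , c , d))
                      (sum-zero (suc k) λ _ → sum-zero (suc k) λ _ → refl)) (sum-cong-≗ λ b →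
      trans (sum-tail (λ c → ∑[ d < suc k ] g (0F , suc b , c , d))
                      (sum-zero (suc k) λ _ → refl)) (sum-cong-≗ λ c →
      sum-tail (λ d → g (0F , suc b , suc c , d)) refl))

    avoiding0 : ∑[ a < k ] ∑T (suc k) (λ b c d → g (suc a , b , c , d)) ≡ ∑C k (h ∘ shift)
    avoiding0 = sum-cong-≗ λ a →
      trans (sum-tail (λ b → ∑[ c < suc k ] ∑[ d < suc k ] g (suc a , b , c , d))
                      (sum-zero (suc k) λ _ → sum-zero (suc k) λ _ → refl)) (sum-cong-≗ λ b →
      trans (sum-tail (λ c → ∑[ d < suc k ] g (suc a , suc b , c , d))
                      (sum-zero (suc k) λ d → cong (if_then h (suc a , suc b , 0F , d) else 0#) (∧-zeroʳ (a <F b))))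
            (sum-cong-≗ λ c →
      sum-tail (λ d → g (suc a , suc b , suc c , d))
        (cong (if_then h (suc a , suc b , suc c , 0F) else 0#)
              (trans (cong ((a <F b) ∧_) (∧-zeroʳ (a <F c))) (∧-zeroʳ (a <F b))))))

  ∑Q-δ : ∀ {k} (q : Quad k) (h : Quad k → A) → ∑Q k (λ q′ → if q′ =Q q then h q′ else 0#) ≡ h q
  ∑Q-δ {k} (a , b , c , d) h =
    trans (sum-cong-≗ λ a′ → guard₃ (a′ =F a) _ _) (trans (sum-δ a _) (
    trans (sum-cong-≗ λ b′ → guard₂ (b′ =F b) _ _) (trans (sum-δ b _) (
    trans (sum-cong-≗ λ c′ → guard₁ (c′ =F c) _ _) (trans (sum-δ c _) (sum-δ d _))))))
    where
    guard₁ : ∀ x (R : Fin k → Bool) (G : Fin k → A) →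
             ∑[ i < k ] (if x ∧ R i then G i else 0#) ≡ (if x then ∑[ i < k ] (if R i then G i else 0#) else 0#)
    guard₁ true R G = refl
    guard₁ false R G = sum-zero k λ _ → refl
    guard₂ : ∀ x (R : Fin k → Fin k → Bool) (G : Fin k → Fin k → A) →
             ∑[ i < k ] ∑[ j < k ] (if x ∧ R i j then G i j else 0#) ≡
             (if x then ∑[ i < k ] ∑[ j < k ] (if R i j then G i j else 0#) else 0#)
    guard₂ true R G = refl
    guard₂ false R G = sum-zero k λ _ → sum-zero k λ _ → refl
    guard₃ : ∀ x (R : Fin k → Fin k → Fin k → Bool) (G : Fin k → Fin k → Fin k → A) →
             ∑T k (λ i j l → if x ∧ R i j l then G i j l else 0#) ≡
             (if x then ∑T k (λ i j l → if R i j l then G i j l else 0#) else 0#)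
    guard₃ true R G = refl
    guard₃ false R G = sum-zero k λ _ → sum-zero k λ _ → sum-zero k λ _ → refl

  ∑T-fan : ∀ m (g : Fin (suc (suc (suc m))) → Fin (suc (suc (suc m))) → Fin (suc (suc (suc m))) → A) →
           (∀ b c d → fan b c d ≡ false → g b c d ≡ 0#) →
           ∑T (suc (suc (suc m))) g ≡ ((g 0F 1F 2F + (∑[ j < m ] g 0F 1F (suc (suc (suc j))))) + g 0F 2F 1F) + g 1F 0F 2F
  ∑T-fan m g g-fan = begin
      row 0F + (row 1F + (∑[ b < suc m ] row (suc (suc b))))
    ≡⟨ cong₂ _+_ row₀ (cong (row 1F +_) (sum-zero (suc m) λ b → sum-zero k λ c → empty (suc (suc b)) c λ _ → refl)) ⟩
      ((g 0F 1F 2F + S) + g 0F 2F 1F) + (row 1F + 0#)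
    ≡⟨ cong (((g 0F 1F 2F + S) + g 0F 2F 1F) +_) (trans (identityʳ _) row₁) ⟩
      ((g 0F 1F 2F + S) + g 0F 2F 1F) + g 1F 0F 2F
    ∎
    where
    k = suc (suc (suc m))
    S = ∑[ j < m ] g 0F 1F (suc (suc (suc j)))
    row : Fin k → A
    row b = ∑[ c < k ] ∑[ d < k ] g b c d
    off : ∀ {b c d} → fan b c d ≡ false → g b c d ≡ 0#
    off {b} {c} {d} = g-fan b c d
    empty : ∀ b c → (∀ d → fan b c d ≡ false) → ∑[ d < k ] g b c d ≡ 0#
    empty b c none = sum-zero k λ d → off (none d)
    row₀ : row 0F ≡ (g 0F 1F 2F + S) + g 0F 2F 1F
    row₀ = trans (cong₂ _+_ (empty 0F 0F λ _ → refl)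
                            (cong₂ _+_ edge₀₁ (cong₂ _+_ edge₀₂ (sum-zero m λ c → empty 0F (suc (suc (suc c))) λ _ → refl))))
                 (trans (identityˡ _) (cong ((g 0F 1F 2F + S) +_) (identityʳ _)))
      where
      edge₀₁ : ∑[ d < k ] g 0F 1F d ≡ g 0F 1F 2F + S
      edge₀₁ = trans (cong₂ _+_ (off refl) (cong₂ _+_ (off refl) refl)) (trans (identityˡ _) (identityˡ _))
      edge₀₂ : ∑[ d < k ] g 0F 2F d ≡ g 0F 2F 1F
      edge₀₂ = trans (cong₂ _+_ (off refl) (cong (g 0F 2F 1F +_) (cong₂ _+_ (off refl) (sum-zero m λ _ → off refl))))
                     (trans (identityˡ _) (trans (cong (g 0F 2F 1F +_) (identityʳ 0#)) (identityʳ _)))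
    row₁ : row 1F ≡ g 1F 0F 2F
    row₁ = trans (cong₂ _+_ edge₁₀ (sum-zero (suc (suc m)) λ c → empty 1F (suc c) λ _ → refl)) (identityʳ _)
      where
      edge₁₀ : ∑[ d < k ] g 1F 0F d ≡ g 1F 0F 2F
      edge₁₀ = trans (cong₂ _+_ (off refl) (cong₂ _+_ (off refl) (cong (g 1F 0F 2F +_) (sum-zero m λ _ → off refl))))
                     (trans (identityˡ _) (trans (identityˡ _) (identityʳ _)))

module Counting where

  open import Data.Nat using (_+_; _*_; _∸_; _≤_; s≤s; z≤n)
  open import Data.Nat.Tactic.RingSolver using (solve-∀)
  open Sums ℕ.+-0-isCommutativeMonoid

  ⟦_⟧ : Bool → ℕ
  ⟦ b ⟧ = if b then 1 else 0

  sum-1 : ∀ n → ∑[ i < n ] 1 ≡ n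
  sum-1 zero = refl
  sum-1 (suc n) = cong suc (sum-1 n)

  count-< : ∀ k → ∑[ b < k ] ∑[ d < k ] ⟦ b <F d ⟧ ≡ k C 2
  count-< zero = refl
  count-< (suc k) = begin
    ∑[ d < k ] 1 + ∑[ b < k ] ∑[ d < k ] ⟦ b <F d ⟧ ≡⟨ cong₂ _+_ (trans (sum-1 k) (sym (nC1≡n k))) (count-< k) ⟩
    k C 1 + k C 2                                     ≡⟨ nCk+nC[k+1]≡[n+1]C[k+1] k 1 ⟩
    suc k C 2                                         ∎

  count-≢ : ∀ k → ∑[ c < k ] ∑[ d < k ] ⟦ not (c =F d) ⟧ ≡ 2 * (k C 2)
  count-≢ zero = refl
  count-≢ (suc k) = begin
    ∑[ d < k ] 1 + ∑[ c < k ] (1 + ∑[ d < k ] ⟦ not (c =F d) ⟧)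
      ≡⟨ cong₂ _+_ (sum-1 k) (trans (∑-distrib-+ {k} (λ _ → 1) (λ c → ∑[ d < k ] ⟦ not (c =F d) ⟧))
                                    (cong₂ _+_ (sum-1 k) (count-≢ k))) ⟩
    k + (k + 2 * (k C 2))
      ≡⟨ twice k (k C 2) ⟩
    2 * (k + k C 2)
      ≡⟨ cong (λ x → 2 * (x + k C 2)) (sym (nC1≡n k)) ⟩
    2 * (k C 1 + k C 2)
      ≡⟨ cong (2 *_) (nCk+nC[k+1]≡[n+1]C[k+1] k 1) ⟩
    2 * (suc k C 2)
      ∎
    where
    twice : ∀ a b → a + (a + 2 * b) ≡ 2 * (a + b)
    twice = solve-∀

  -- The triples (b , c , d) with (0 , b , c , d) canonical are the paths b - c - d, each taken once (b < d).
  count-paths : ∀ k → ∑T k (λ b c d → ⟦ canonical (0F , suc b , suc c , suc d) ⟧) ≡ 3 * (k C 3)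
  count-paths zero = refl
  count-paths (suc k) = begin
    ((∑[ d < suc k ] ⟦ canonical (0F , 1F , 1F , suc d) ⟧) + (∑[ c < k ] ∑[ d < k ] ⟦ not (c =F d) ⟧))
      + ∑[ b < k ] ((∑[ d < k ] ⟦ (b <F d) ∧ true ⟧) + paths-from b)
      ≡⟨ cong₂ _+_ (cong (_+ (∑[ c < k ] ∑[ d < k ] ⟦ not (c =F d) ⟧)) (sum-zero (suc k) λ _ → refl))
                   (trans (sum-cong-≗ λ b → cong (_+ paths-from b) (sum-cong-≗ λ d → cong ⟦_⟧ (∧-identityʳ (b <F d))))
                          (∑-distrib-+ {k} (λ b → ∑[ d < k ] ⟦ b <F d ⟧) paths-from)) ⟩
    (∑[ c < k ] ∑[ d < k ] ⟦ not (c =F d) ⟧) + ((∑[ b < k ] ∑[ d < k ] ⟦ b <F d ⟧) + ∑T k paths)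
      ≡⟨ cong₂ _+_ (count-≢ k) (cong₂ _+_ (count-< k) (count-paths k)) ⟩
    2 * (k C 2) + (k C 2 + 3 * (k C 3))
      ≡⟨ thrice (k C 2) (k C 3) ⟩
    3 * (k C 2 + k C 3)
      ≡⟨ cong (3 *_) (nCk+nC[k+1]≡[n+1]C[k+1] k 2) ⟩
    3 * (suc k C 3)
      ∎
    where
    paths : Fin k → Fin k → Fin k → ℕ
    paths b c d = ⟦ canonical (0F , suc b , suc c , suc d) ⟧
    paths-from : Fin k → ℕ
    paths-from b = ∑[ c < k ] ∑[ d < k ] paths b c d
    thrice : ∀ a b → 2 * a + (a + 3 * b) ≡ 3 * (a + b)
    thrice = solve-∀

  count-cycles : ∀ k → ∑C k (λ _ → 1) ≡ 3 * (k C 4)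
  count-cycles zero = refl
  count-cycles (suc k) = begin
    ∑C (suc k) (λ _ → 1)                    ≡⟨ ∑C-suc k (λ _ → 1) ⟩
    ∑T k (λ b c d → ⟦ canonical (0F , suc b , suc c , suc d) ⟧) + ∑C k (λ _ → 1)
                                            ≡⟨ cong₂ _+_ (count-paths k) (count-cycles k) ⟩
    3 * (k C 3) + 3 * (k C 4)               ≡⟨ ℕ.*-distribˡ-+ 3 (k C 3) (k C 4) ⟨
    3 * (k C 3 + k C 4)                     ≡⟨ cong (3 *_) (nCk+nC[k+1]≡[n+1]C[k+1] k 3) ⟩
    3 * (suc k C 4)                         ∎

  numCycles≡ : ∀ k → numCycles k ≡ 3 * (k C 4)
  numCycles≡ k = begin
    numCycles k               ≡⟨ sum-1 (numCycles k) ⟨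
    ∑[ i < numCycles k ] 1    ≡⟨ sum-cycles k (λ _ → 1) ⟩
    ∑C k (λ _ → 1)            ≡⟨ count-cycles k ⟩
    3 * (k C 4)               ∎

  countCycles : ∀ k → (Quad k → Bool) → ℕ
  countCycles k p = ∑C k (λ q → ⟦ p q ⟧)

  countCycles-extend : ∀ m (p : Quad (suc (suc (suc (suc m)))) → Bool) →
                       (∀ b c d → p (0F , suc b , suc c , suc d) ≡ fan b c d) →
                       countCycles (suc (suc (suc m))) (p ∘ shift) ≡ suc (suc (suc m)) C 2 →
                       countCycles (suc (suc (suc (suc m)))) p ≡ suc (suc (suc (suc m))) C 2
  countCycles-extend m p p-fan old = begin
    countCycles (suc k) p
      ≡⟨ ∑C-suc k (λ q → ⟦ p q ⟧) ⟩
    ∑T k (λ b c d → if canonical (0F , suc b , suc c , suc d) then ⟦ p (0F , suc b , suc c , suc d) ⟧ else 0)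
      + countCycles k (p ∘ shift)
      ≡⟨ cong₂ _+_ (trans (sum-cong-≗ λ b → sum-cong-≗ λ c → sum-cong-≗ λ d → cong (new b c d) (p-fan b c d))
                          (∑T-fan m (λ b c d → new b c d (fan b c d))
                                  (λ b c d off → trans (cong (new b c d) off) (if-eta (canonical (0F , suc b , suc c , suc d))))))
                   old ⟩
    ((1 + ∑[ j < m ] 1) + 1) + 1 + k C 2
      ≡⟨ cong (λ x → ((1 + x) + 1) + 1 + k C 2) (sum-1 m) ⟩
    ((1 + m) + 1) + 1 + k C 2
      ≡⟨ cong (_+ k C 2) (arith m) ⟩
    k + k C 2
      ≡⟨ cong (_+ k C 2) (nC1≡n k) ⟨
    k C 1 + k C 2
      ≡⟨ nCk+nC[k+1]≡[n+1]C[k+1] k 1 ⟩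
    suc k C 2
      ∎
    where
    k = suc (suc (suc m))
    new : Fin k → Fin k → Fin k → Bool → ℕ
    new b c d x = if canonical (0F , suc b , suc c , suc d) then ⟦ x ⟧ else 0
    arith : ∀ m → ((1 + m) + 1) + 1 ≡ 3 + m
    arith = solve-∀

  occurrences : ∀ k (q : Quad k) → ∑[ i < numCycles k ] ⟦ cycle k i =Q q ⟧ ≡ ⟦ canonical q ⟧
  occurrences k q = begin
    ∑[ i < numCycles k ] ⟦ cycle k i =Q q ⟧                ≡⟨ sum-cycles k (λ q′ → ⟦ q′ =Q q ⟧) ⟩
    ∑C k (λ q′ → ⟦ q′ =Q q ⟧)                              ≡⟨ ∑Q-cong (λ q′ → swap (canonical q′) (q′ =Q q)) ⟩
    ∑Q k (λ q′ → if q′ =Q q then ⟦ canonical q′ ⟧ else 0)  ≡⟨ ∑Q-δ q (λ q′ → ⟦ canonical q′ ⟧) ⟩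
    ⟦ canonical q ⟧                                        ∎
    where
    swap : ∀ x y → (if x then ⟦ y ⟧ else 0) ≡ (if y then ⟦ x ⟧ else 0)
    swap false false = refl
    swap false true = refl
    swap true false = refl
    swap true true = refl

  1≤sum : ∀ {n} (p : Fin n → Bool) i → p i ≡ true → 1 ≤ ∑[ l < n ] ⟦ p l ⟧
  1≤sum p zero pi rewrite pi = s≤s z≤n
  1≤sum p (suc i) pi = ℕ.≤-trans (1≤sum (p ∘ suc) i pi) (ℕ.m≤n+m _ ⟦ p zero ⟧)

  2≤sum : ∀ {n} (p : Fin n → Bool) i j → (i =F j) ≡ false → p i ≡ true → p j ≡ true → 2 ≤ ∑[ l < n ] ⟦ p l ⟧
  2≤sum p zero (suc j) _ pi pj rewrite pi = s≤s (1≤sum (p ∘ suc) j pj)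
  2≤sum p (suc i) zero _ pi pj rewrite pj = s≤s (1≤sum (p ∘ suc) i pi)
  2≤sum p (suc i) (suc j) i≠j pi pj = ℕ.≤-trans (2≤sum (p ∘ suc) i j i≠j pi pj) (ℕ.m≤n+m _ ⟦ p zero ⟧)

  -- No 4-cycle is listed twice: its number of occurrences is ⟦ canonical q ⟧ ≤ 1.
  cycle-=Q : ∀ k (i j : Fin (numCycles k)) → (cycle k i =Q cycle k j) ≡ (i =F j)
  cycle-=Q k i j with i =F j in i=j
  ... | true = subst (λ i → (cycle k i =Q cycle k j) ≡ true) (sym (=F⇒≡ i=j)) (=Q-refl (cycle k j))
  ... | false with cycle k i =Q cycle k j in ci=cj
  ...   | false = refl
  ...   | true = contradiction (2≤sum (λ l → cycle k l =Q cycle k j) i j i=j ci=cj (=Q-refl (cycle k j))) 2≰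
    where
    2≰ : ¬ 2 ≤ ∑[ l < numCycles k ] ⟦ cycle k l =Q cycle k j ⟧
    2≰ rewrite occurrences k (cycle k j) | canonical-cycle k j = λ { (s≤s ()) }

  record Unmarked {m} (p : Fin m → Bool) : Set where
    field
      size : ℕ
      index : Fin size → Fin m
      index-unmarked : ∀ κ → p (index κ) ≡ false
      index-=F : ∀ κ κ′ → (index κ =F index κ′) ≡ (κ =F κ′)
      index-onto : ∀ i → p i ≡ false → ∃ λ κ → index κ ≡ i
      size+marked : size + ∑[ i < m ] ⟦ p i ⟧ ≡ m

  unmarked : ∀ {m} (p : Fin m → Bool) → Unmarked p
  unmarked {zero} p = record
    { size = 0 ; index = λ () ; index-unmarked = λ () ; index-=F = λ () ; index-onto = λ () ; size+marked = refl }
  unmarked {suc m} p with p zero in p0 | unmarked (p ∘ suc)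
  ... | true | U = record
    { size = size
    ; index = suc ∘ index
    ; index-unmarked = index-unmarked
    ; index-=F = index-=F
    ; index-onto = λ { zero p0≡false → contradiction (trans (sym p0) p0≡false) λ ()
                     ; (suc i) pi → Product.map₂ (cong suc) (index-onto i pi) }
    ; size+marked = trans (cong (λ b → size + (⟦ b ⟧ + ∑[ i < m ] ⟦ p (suc i) ⟧)) p0)
                          (trans (ℕ.+-suc size _) (cong suc size+marked))
    }
    where open Unmarked U
  ... | false | U = record
    { size = suc size
    ; index = index′
    ; index-unmarked = λ { zero → p0 ; (suc κ) → index-unmarked κ }
    ; index-=F = λ { zero zero → refl ; zero (suc κ′) → refl ; (suc κ) zero → refl
                   ; (suc κ) (suc κ′) → index-=F κ κ′ }
    ; index-onto = λ { zero _ → zero , refl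
                     ; (suc i) pi → Product.map suc (cong suc) (index-onto i pi) }
    ; size+marked = trans (cong (λ b → suc size + (⟦ b ⟧ + ∑[ i < m ] ⟦ p (suc i) ⟧)) p0) (cong suc size+marked)
    }
    where
    open Unmarked U
    index′ : Fin (suc size) → Fin (suc m)
    index′ zero = zero
    index′ (suc κ) = suc (index κ)

  unmarked-size : ∀ k (p : Quad k → Bool) → countCycles k p ≡ k C 2 →
                  Unmarked.size (unmarked (p ∘ cycle k)) ≡ 3 * (k C 4) ∸ k C 2
  unmarked-size k p count = begin
    size                                              ≡⟨ ℕ.m+n∸n≡m size (k C 2) ⟨
    size + k C 2 ∸ k C 2                              ≡⟨ cong (λ c → size + c ∸ k C 2) count ⟨
    size + countCycles k p ∸ k C 2                    ≡⟨ cong (λ c → size + c ∸ k C 2) (sum-cycles k (λ q → ⟦ p q ⟧)) ⟨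
    size + ∑[ i < numCycles k ] ⟦ p (cycle k i) ⟧ ∸ k C 2 ≡⟨ cong (_∸ k C 2) size+marked ⟩
    numCycles k ∸ k C 2                               ≡⟨ cong (_∸ k C 2) (numCycles≡ k) ⟩
    3 * (k C 4) ∸ k C 2                               ∎
    where open Unmarked (unmarked (p ∘ cycle k))

open Counting using (countCycles; countCycles-extend; cycle-=Q; unmarked; unmarked-size)

module Kernel where

  open import Data.Rational using (ℚ; 0ℚ; 1ℚ; ½; -½; _+_; _*_; _-_; -_)
  import Data.Rational.Properties as ℚ
  open import Data.Vec using (Vec; []; _∷_)
  import Data.Vec as Vec
  open import Tactic.RingSolver using (solve-∀)
  open import Tactic.RingSolver.Core.AlmostCommutativeRing using (AlmostCommutativeRing; fromCommutativeRing)

  open Sums ℚ.+-0-isCommutativeMonoid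
  open import Algebra.Properties.Semiring.Sum (Ring.semiring ℚ.+-*-ring) using (*-distribˡ-sum; *-distribʳ-sum)

  ring : AlmostCommutativeRing _ _
  ring = fromCommutativeRing ℚ.+-*-commutativeRing (λ x → dec⇒maybe (0ℚ ℚ.≟ x))

  δ : ∀ {n} → Fin n → Fin n → ℚ
  δ i j = if i =F j then 1ℚ else 0ℚ

  𝟙* : ∀ b x → (if b then 1ℚ else 0ℚ) * x ≡ (if b then x else 0ℚ)
  𝟙* true x = ℚ.*-identityˡ x
  𝟙* false x = ℚ.*-zeroˡ x

  sum-δ-* : ∀ {n} (s : Fin n) (x : Fin n → ℚ) → ∑[ t < n ] (δ t s * x t) ≡ x s
  sum-δ-* s x = trans (sum-cong-≗ λ t → 𝟙* (t =F s) (x t)) (sum-δ s x)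

  ∑-*-∑ : ∀ {m n} (x : Fin m → ℚ) (A : Fin m → Fin n → ℚ) (y : Fin n → ℚ) →
          ∑[ t < m ] (x t * ∑[ e < n ] (A t e * y e)) ≡ ∑[ e < n ] ((∑[ t < m ] (A t e * x t)) * y e)
  ∑-*-∑ {m} {n} x A y = begin
    ∑[ t < m ] (x t * ∑[ e < n ] (A t e * y e))     ≡⟨ sum-cong-≗ (λ t → *-distribˡ-sum (x t) (λ e → A t e * y e)) ⟩
    ∑[ t < m ] ∑[ e < n ] (x t * (A t e * y e))     ≡⟨ ∑-comm (λ t e → x t * (A t e * y e)) ⟩
    ∑[ e < n ] ∑[ t < m ] (x t * (A t e * y e))     ≡⟨ sum-cong-≗ (λ e → sum-cong-≗ λ t → reassoc (x t) (A t e) (y e)) ⟩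
    ∑[ e < n ] ∑[ t < m ] ((A t e * x t) * y e)     ≡⟨ sum-cong-≗ (λ e → *-distribʳ-sum (y e) (λ t → A t e * x t)) ⟨
    ∑[ e < n ] ((∑[ t < m ] (A t e * x t)) * y e)   ∎
    where
    reassoc : ∀ a b c → a * (b * c) ≡ (b * a) * c
    reassoc = solve-∀ ring

  ∑≡sum : ∀ m (f : Fin m → ℚ) → ∑ m f ≡ sum f
  ∑≡sum zero f = refl
  ∑≡sum (suc m) f = cong (f zero +_) (∑≡sum m (f ∘ suc))

  _·_ : ∀ {N} → (Fin N → ℚ) → (Fin N → ℚ) → ℚ
  c · x = ∑[ i < _ ] (c i * x i)

  ·-δ : ∀ {N} (c : Fin N → ℚ) j → c · (λ i → δ i j) ≡ c j
  ·-δ c j = trans (sum-cong-≗ λ i → trans (ℚ.*-comm (c i) (δ i j)) (𝟙* (i =F j) (c i))) (sum-δ j c)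

  ·-sub : ∀ {N} (c x y : Fin N → ℚ) → c · (λ i → x i - y i) ≡ c · x - c · y
  ·-sub {N} c x y = begin
    ∑[ i < N ] (c i * (x i - y i))
      ≡⟨ sum-cong-≗ (λ i → split (c i) (x i) (y i)) ⟩
    ∑[ i < N ] (c i * x i + (- 1ℚ) * (c i * y i))
      ≡⟨ ∑-distrib-+ (λ i → c i * x i) (λ i → (- 1ℚ) * (c i * y i)) ⟩
    c · x + ∑[ i < N ] ((- 1ℚ) * (c i * y i))
      ≡⟨ cong (c · x +_) (*-distribˡ-sum (- 1ℚ) (λ i → c i * y i)) ⟨
    c · x + (- 1ℚ) * (c · y)
      ≡⟨ fold (c · x) (c · y) ⟩
    c · x - c · y
      ∎
    where
    split : ∀ m x y → m * (x - y) ≡ m * x + (- 1ℚ) * (m * y)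
    split = solve-∀ ring
    fold : ∀ a b → a + (- 1ℚ) * b ≡ a - b
    fold = solve-∀ ring

  ·-lincomb : ∀ {N d} (c : Fin N → ℚ) (α : Fin d → ℚ) vs → (∀ κ → c · vs κ ≡ 0ℚ) → c · lincomb α vs ≡ 0ℚ
  ·-lincomb {N} {d} c α vs c·vs≡0 = begin
    ∑[ i < N ] (c i * ∑ d (λ κ → α κ * vs κ i))
      ≡⟨ sum-cong-≗ (λ i → cong (c i *_) (∑≡sum d (λ κ → α κ * vs κ i))) ⟩
    ∑[ i < N ] (c i * ∑[ κ < d ] (α κ * vs κ i))
      ≡⟨ sum-cong-≗ (λ i → *-distribˡ-sum (c i) (λ κ → α κ * vs κ i)) ⟩
    ∑[ i < N ] ∑[ κ < d ] (c i * (α κ * vs κ i))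
      ≡⟨ ∑-comm (λ i κ → c i * (α κ * vs κ i)) ⟩
    ∑[ κ < d ] ∑[ i < N ] (c i * (α κ * vs κ i))
      ≡⟨ sum-cong-≗ (λ κ → sum-cong-≗ λ i → swap (c i) (α κ) (vs κ i)) ⟩
    ∑[ κ < d ] ∑[ i < N ] (α κ * (c i * vs κ i))
      ≡⟨ sum-cong-≗ (λ κ → *-distribˡ-sum (α κ) (λ i → c i * vs κ i)) ⟨
    ∑[ κ < d ] (α κ * (c · vs κ))
      ≡⟨ sum-zero d (λ κ → trans (cong (α κ *_) (c·vs≡0 κ)) (ℚ.*-zeroʳ (α κ))) ⟩
    0ℚ
      ∎
    where
    swap : ∀ m a v → m * (a * v) ≡ a * (m * v)
    swap = solve-∀ ring

  pairwise-sums-zero : ∀ a c e → a + c ≡ 0ℚ → c + e ≡ 0ℚ → a + e ≡ 0ℚ → a ≡ 0ℚ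
  pairwise-sums-zero a c e ac ce ae = begin
    a                                     ≡⟨ halves a c e ⟩
    ½ * (((a + c) - (c + e)) + (a + e))   ≡⟨ cong₂ (λ x z → ½ * ((x - z) + (a + e))) ac ce ⟩
    ½ * ((0ℚ - 0ℚ) + (a + e))             ≡⟨ cong (λ x → ½ * ((0ℚ - 0ℚ) + x)) ae ⟩
    ½ * ((0ℚ - 0ℚ) + 0ℚ)                  ≡⟨⟩
    0ℚ                                    ∎
    where
    halves : ∀ a c e → a ≡ ½ * (((a + c) - (c + e)) + (a + e))
    halves = solve-∀ ring

  SupportedOn : ∀ {X : Set} → (X → Bool) → (X → ℚ) → Set
  SupportedOn T f = ∀ x → T x ≡ false → f x ≡ 0ℚ

  incidence : ∀ {k} → Fin k → Fin k → Quad k → ℚ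
  incidence a b q = if edgeIn a b q then 1ℚ else 0ℚ

  -- M and InKernel for functions on all quadruples, of which only the canonical ones are columns of M.
  M′ : ∀ k → (Quad k → ℚ) → Fin k → Fin k → ℚ
  M′ k f a b = ∑C k (λ q → incidence a b q * f q)

  InKernel′ : ∀ k → (Quad k → ℚ) → Set
  InKernel′ k f = ∀ a b → (a <F b) ≡ true → M′ k f a b ≡ 0ℚ

  M′-cong : ∀ {k} {f g : Quad k → ℚ} → (∀ q → f q ≡ g q) → ∀ a b → M′ k f a b ≡ M′ k g a b
  M′-cong f≗g a b = ∑Q-cong λ q → cong (λ x → if canonical q then incidence a b q * x else 0ℚ) (f≗g q)

  record CycleBasis (k : ℕ) : Set where
    field
      basic : Quad k → Bool
      count-basic : countCycles k basic ≡ k C 2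
      solve : (Fin k → Fin k → ℚ) → Quad k → ℚ
      solve-supported : ∀ w → SupportedOn basic (solve w)
      M′-solve : ∀ w a b → (a <F b) ≡ true → M′ k (solve w) a b ≡ w a b
      kernel-trivial : ∀ f → SupportedOn basic f → InKernel′ k f → ∀ q → f q ≡ 0ℚ

  sparse : ∀ {k n} → (Fin n → Quad k) → (Fin n → ℚ) → Quad k → ℚ
  sparse p c q = ∑[ t < _ ] (if q =Q p t then c t else 0ℚ)

  M′-sparse : ∀ {k n} (p : Fin n → Quad k) (c : Fin n → ℚ) a b →
              M′ k (sparse p c) a b ≡ ∑[ t < n ] (if canonical (p t) then incidence a b (p t) * c t else 0ℚ)
  M′-sparse {k} {n} p c a b = begin
    ∑C k (λ q → incidence a b q * sparse p c q)                ≡⟨ ∑Q-cong pointwise ⟩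
    ∑Q k (λ q → ∑[ t < n ] (if q =Q p t then g t q else 0ℚ))  ≡⟨ ∑Q-comm (λ t q → if q =Q p t then g t q else 0ℚ) ⟩
    ∑[ t < n ] ∑Q k (λ q → if q =Q p t then g t q else 0ℚ)    ≡⟨ sum-cong-≗ (λ t → ∑Q-δ (p t) (g t)) ⟩
    ∑[ t < n ] g t (p t)                                       ∎
    where
    g : Fin n → Quad k → ℚ
    g t q = if canonical q then incidence a b q * c t else 0ℚ
    pointwise : ∀ q → (if canonical q then incidence a b q * sparse p c q else 0ℚ) ≡
                      ∑[ t < n ] (if q =Q p t then g t q else 0ℚ)
    pointwise q with canonical q
    ... | true = trans (*-distribˡ-sum (incidence a b q) (λ t → if q =Q p t then c t else 0ℚ))
                       (sum-cong-≗ λ t → trans (if-float (incidence a b q *_) (q =Q p t))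
                                              (cong (if q =Q p t then incidence a b q * c t else_) (ℚ.*-zeroʳ (incidence a b q))))
    ... | false = sym (sum-zero n λ t → if-eta (q =Q p t))

  sparse-at : ∀ {k n} (p : Fin n → Quad k) → (∀ s t → (p s =Q p t) ≡ (t =F s)) → ∀ c s → sparse p c (p s) ≡ c s
  sparse-at p p-inj c s = trans (sum-cong-≗ λ t → cong (if_then c t else 0ℚ) (p-inj s t)) (sum-δ s c)

  sparse-outside : ∀ {k n} (p : Fin n → Quad k) c q → (∀ t → q ≢ p t) → sparse p c q ≡ 0ℚ
  sparse-outside {n = n} p c q q∉p = sum-zero n off
    where
    off : ∀ t → (if q =Q p t then c t else 0ℚ) ≡ 0ℚ
    off t with q =Q p t in q=p
    ... | true = contradiction (=Q⇒≡ q=p) (q∉p t)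
    ... | false = refl

  -- Extending a cycle basis by a new vertex

  -- A function on the quadruples of K_{k+1} built from its values on the cycles through 0 and on those
  -- avoiding 0; quadruples of neither kind (0 repeated, or 0 not in front) get x₀.
  extend : ∀ {k} {X : Set} → X → (Fin k → Fin k → Fin k → X) → (Quad k → X) → Quad (suc k) → X
  extend x₀ new old (0F , suc b , suc c , suc d) = new b c d
  extend x₀ new old (suc a , suc b , suc c , suc d) = old (a , b , c , d)
  extend x₀ new old (0F , 0F , _ , _) = x₀
  extend x₀ new old (0F , suc _ , 0F , _) = x₀
  extend x₀ new old (0F , suc _ , suc _ , 0F) = x₀
  extend x₀ new old (suc _ , 0F , _ , _) = x₀
  extend x₀ new old (suc _ , suc _ , 0F , _) = x₀
  extend x₀ new old (suc _ , suc _ , suc _ , 0F) = x₀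

  extend-supported : ∀ {k} {T₀ : Fin k → Fin k → Fin k → Bool} {T f₀ f} →
                     (∀ b c d → T₀ b c d ≡ false → f₀ b c d ≡ 0ℚ) → SupportedOn T f →
                     SupportedOn (extend false T₀ T) (extend 0ℚ f₀ f)
  extend-supported f₀-T₀ f-T (0F , suc b , suc c , suc d) = f₀-T₀ b c d
  extend-supported f₀-T₀ f-T (suc a , suc b , suc c , suc d) = f-T (a , b , c , d)
  extend-supported f₀-T₀ f-T (0F , 0F , _ , _) _ = refl
  extend-supported f₀-T₀ f-T (0F , suc _ , 0F , _) _ = refl
  extend-supported f₀-T₀ f-T (0F , suc _ , suc _ , 0F) _ = refl
  extend-supported f₀-T₀ f-T (suc _ , 0F , _ , _) _ = refl
  extend-supported f₀-T₀ f-T (suc _ , suc _ , 0F , _) _ = refl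
  extend-supported f₀-T₀ f-T (suc _ , suc _ , suc _ , 0F) _ = refl

  extend-vanishing : ∀ {k} {T₀ : Fin k → Fin k → Fin k → Bool} {T} (f : Quad (suc k) → ℚ) →
                     SupportedOn (extend false T₀ T) f →
                     (∀ b c d → f (0F , suc b , suc c , suc d) ≡ 0ℚ) → (∀ q → f (shift q) ≡ 0ℚ) →
                     ∀ q → f q ≡ 0ℚ
  extend-vanishing f f-T new old (0F , suc b , suc c , suc d) = new b c d
  extend-vanishing f f-T new old (suc a , suc b , suc c , suc d) = old (a , b , c , d)
  extend-vanishing f f-T new old q@(0F , 0F , _ , _) = f-T q refl
  extend-vanishing f f-T new old q@(0F , suc _ , 0F , _) = f-T q refl
  extend-vanishing f f-T new old q@(0F , suc _ , suc _ , 0F) = f-T q refl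
  extend-vanishing f f-T new old q@(suc _ , 0F , _ , _) = f-T q refl
  extend-vanishing f f-T new old q@(suc _ , suc _ , 0F , _) = f-T q refl
  extend-vanishing f f-T new old q@(suc _ , suc _ , suc _ , 0F) = f-T q refl

  module Extension (m : ℕ) (B : CycleBasis (suc (suc (suc m)))) where

    open CycleBasis B

    k K : ℕ
    k = suc (suc (suc m))
    K = suc k

    Triple : Set
    Triple = Fin k → Fin k → Fin k → ℚ

    fanLoad : Triple → Fin K → Fin K → ℚ
    fanLoad y a b = ∑T k (λ b′ c d → if canonical (0F , suc b′ , suc c , suc d)
                                       then incidence a b (0F , suc b′ , suc c , suc d) * y b′ c d else 0ℚ)

    through0 : (Quad K → ℚ) → Triple
    through0 f b c d = f (0F , suc b , suc c , suc d)

    M′-suc : ∀ f a b → M′ K f a b ≡ fanLoad (through0 f) a b + ∑C k (λ q → incidence a b (shift q) * f (shift q))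
    M′-suc f a b = ∑C-suc k (λ q → incidence a b q * f q)

    M′-suc-0 : ∀ f j → M′ K f 0F (suc j) ≡ fanLoad (through0 f) 0F (suc j)
    M′-suc-0 f j = trans (M′-suc f 0F (suc j))
      (trans (cong (fanLoad (through0 f) 0F (suc j) +_)
                   (sum-zero k λ a → sum-zero k λ b → sum-zero k λ c → sum-zero k λ d →
                     trans (cong (if canonical (a , b , c , d) then_else 0ℚ) (ℚ.*-zeroˡ (f (shift (a , b , c , d)))))
                           (if-eta (canonical (a , b , c , d)))))
             (ℚ.+-identityʳ _))

    FanSupported : Triple → Set
    FanSupported y = ∀ b c d → fan b c d ≡ false → y b c d ≡ 0ℚ

    module FanLoads (y : Triple) (y-fan : FanSupported y) where

      y₀₁₂ y₀₂₁ y₁₀₂ tail : ℚ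
      y₀₁₂ = y 0F 1F 2F
      y₀₂₁ = y 0F 2F 1F
      y₁₀₂ = y 1F 0F 2F
      tail = ∑[ i < m ] y 0F 1F (suc (suc (suc i)))

      summand : Fin K → Fin K → Triple
      summand a b b′ c d = if canonical (0F , suc b′ , suc c , suc d)
                           then incidence a b (0F , suc b′ , suc c , suc d) * y b′ c d else 0ℚ

      fanLoad-fan : ∀ a b → fanLoad y a b ≡
        ((summand a b 0F 1F 2F + (∑[ i < m ] summand a b 0F 1F (suc (suc (suc i))))) + summand a b 0F 2F 1F) + summand a b 1F 0F 2F
      fanLoad-fan a b = ∑T-fan m (summand a b) λ b′ c d off →
        trans (cong (if canonical (0F , suc b′ , suc c , suc d) then_else 0ℚ)
                    (trans (cong (incidence a b (0F , suc b′ , suc c , suc d) *_) (y-fan b′ c d off))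
                           (ℚ.*-zeroʳ (incidence a b (0F , suc b′ , suc c , suc d)))))
              (if-eta (canonical (0F , suc b′ , suc c , suc d)))

      load₀₁ : fanLoad y 0F 1F ≡ (y₀₁₂ + tail) + y₀₂₁
      load₀₁ = trans (fanLoad-fan 0F 1F)
        (trans (cong (λ t → ((1ℚ * y₀₁₂ + t) + 1ℚ * y₀₂₁) + 0ℚ * y₁₀₂)
                     (sum-cong-≗ λ i → ℚ.*-identityˡ (y 0F 1F (suc (suc (suc i))))))
               (simplify y₀₁₂ tail y₀₂₁ y₁₀₂))
        where
        simplify : ∀ a t c e → ((1ℚ * a + t) + 1ℚ * c) + 0ℚ * e ≡ (a + t) + c
        simplify = solve-∀ ring

      load₀₂ : fanLoad y 0F 2F ≡ y₀₂₁ + y₁₀₂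
      load₀₂ = trans (fanLoad-fan 0F 2F)
        (trans (cong (λ t → ((0ℚ * y₀₁₂ + t) + 1ℚ * y₀₂₁) + 1ℚ * y₁₀₂)
                     (sum-zero m λ i → ℚ.*-zeroˡ (y 0F 1F (suc (suc (suc i))))))
               (simplify y₀₁₂ y₀₂₁ y₁₀₂))
        where
        simplify : ∀ a c e → ((0ℚ * a + 0ℚ) + 1ℚ * c) + 1ℚ * e ≡ c + e
        simplify = solve-∀ ring

      load₀₃ : fanLoad y 0F 3F ≡ y₀₁₂ + y₁₀₂
      load₀₃ = trans (fanLoad-fan 0F 3F)
        (trans (cong (λ t → ((1ℚ * y₀₁₂ + t) + 0ℚ * y₀₂₁) + 1ℚ * y₁₀₂)
                     (sum-zero m λ i → ℚ.*-zeroˡ (y 0F 1F (suc (suc (suc i))))))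
               (simplify y₀₁₂ y₀₂₁ y₁₀₂))
        where
        simplify : ∀ a c e → ((1ℚ * a + 0ℚ) + 0ℚ * c) + 1ℚ * e ≡ a + e
        simplify = solve-∀ ring

      load₀₄₊ : ∀ j → fanLoad y 0F (suc (suc (suc (suc j)))) ≡ y 0F 1F (suc (suc (suc j)))
      load₀₄₊ j = trans (fanLoad-fan 0F (suc (suc (suc (suc j)))))
        (trans (cong (λ t → ((0ℚ * y₀₁₂ + t) + 0ℚ * y₀₂₁) + 0ℚ * y₁₀₂)
                     (trans (sum-cong-≗ λ i → trans (𝟙* (j =F i) (y 0F 1F (suc (suc (suc i)))))
                                                     (cong (if_then y 0F 1F (suc (suc (suc i))) else 0ℚ) (=F-sym j i)))
                            (sum-δ j (λ i → y 0F 1F (suc (suc (suc i)))))))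
               (simplify y₀₁₂ _ y₀₂₁ y₁₀₂))
        where
        simplify : ∀ a t c e → ((0ℚ * a + t) + 0ℚ * c) + 0ℚ * e ≡ t
        simplify = solve-∀ ring

    -- u j is the load asked of the spoke {0 , j+1}. A spoke {0 , v} with v ≥ 4 lies only on 0-1-2-v, which
    -- fixes y(0,1,2,v); then the values on 0-1-2-3, 0-1-3-2, 0-2-1-3 must have the pairwise sums s (what is
    -- left of u 0F), u 2F and u 1F.
    fanSolve : (Fin k → ℚ) → Triple
    fanSolve u b c d = if fan b c d then value b c d else 0ℚ
      where
      s = u 0F - ∑[ i < m ] u (suc (suc (suc i)))
      value : Triple
      value 0F 1F 2F = ½ * ((s - u 1F) + u 2F)
      value 0F 1F (suc (suc (suc i))) = u (suc (suc (suc i)))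
      value 0F 2F 1F = ½ * ((s + u 1F) - u 2F)
      value 1F 0F 2F = ½ * ((u 1F + u 2F) - s)
      value _ _ _ = 0ℚ

    fanSolve-supported : ∀ u → FanSupported (fanSolve u)
    fanSolve-supported u b c d off rewrite off = refl

    fanLoad-fanSolve : ∀ u j → fanLoad (fanSolve u) 0F (suc j) ≡ u j
    fanLoad-fanSolve u 0F = trans load₀₁ (simplify (u 0F) (u 1F) (u 2F) (∑[ i < m ] u (suc (suc (suc i)))))
      where
      open FanLoads (fanSolve u) (fanSolve-supported u)
      simplify : ∀ u₀ u₁ u₂ t → (½ * (((u₀ - t) - u₁) + u₂) + t) + ½ * (((u₀ - t) + u₁) - u₂) ≡ u₀
      simplify = solve-∀ ring
    fanLoad-fanSolve u 1F = trans load₀₂ (simplify (u 0F) (u 1F) (u 2F) (∑[ i < m ] u (suc (suc (suc i)))))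
      where
      open FanLoads (fanSolve u) (fanSolve-supported u)
      simplify : ∀ u₀ u₁ u₂ t → ½ * (((u₀ - t) + u₁) - u₂) + ½ * ((u₁ + u₂) - (u₀ - t)) ≡ u₁
      simplify = solve-∀ ring
    fanLoad-fanSolve u 2F = trans load₀₃ (simplify (u 0F) (u 1F) (u 2F) (∑[ i < m ] u (suc (suc (suc i)))))
      where
      open FanLoads (fanSolve u) (fanSolve-supported u)
      simplify : ∀ u₀ u₁ u₂ t → ½ * (((u₀ - t) - u₁) + u₂) + ½ * ((u₁ + u₂) - (u₀ - t)) ≡ u₂
      simplify = solve-∀ ring
    fanLoad-fanSolve u (suc (suc (suc j))) = load₀₄₊ j
      where open FanLoads (fanSolve u) (fanSolve-supported u)

    fan-injective : ∀ y → FanSupported y → (∀ j → fanLoad y 0F (suc j) ≡ 0ℚ) → ∀ b c d → y b c d ≡ 0ℚ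
    fan-injective y y-fan loads-0 b c d with fan b c d in fan-bcd
    ... | false = y-fan b c d fan-bcd
    ... | true = on-fan b c d fan-bcd
      where
      open FanLoads y y-fan
      tail-0 : ∀ i → y 0F 1F (suc (suc (suc i))) ≡ 0ℚ
      tail-0 i = trans (sym (load₀₄₊ i)) (loads-0 (suc (suc (suc i))))
      y₀₁₂+y₀₂₁ : y₀₁₂ + y₀₂₁ ≡ 0ℚ
      y₀₁₂+y₀₂₁ = begin
        y₀₁₂ + y₀₂₁            ≡⟨ cong (λ x → x + y₀₂₁) (ℚ.+-identityʳ y₀₁₂) ⟨
        (y₀₁₂ + 0ℚ) + y₀₂₁     ≡⟨ cong (λ t → (y₀₁₂ + t) + y₀₂₁) (sum-zero m tail-0) ⟨
        (y₀₁₂ + tail) + y₀₂₁   ≡⟨ load₀₁ ⟨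
        fanLoad y 0F 1F        ≡⟨ loads-0 0F ⟩
        0ℚ                     ∎
      y₀₂₁+y₁₀₂ : y₀₂₁ + y₁₀₂ ≡ 0ℚ
      y₀₂₁+y₁₀₂ = trans (sym load₀₂) (loads-0 1F)
      y₀₁₂+y₁₀₂ : y₀₁₂ + y₁₀₂ ≡ 0ℚ
      y₀₁₂+y₁₀₂ = trans (sym load₀₃) (loads-0 2F)
      on-fan : ∀ b c d → fan b c d ≡ true → y b c d ≡ 0ℚ
      on-fan 0F 1F 2F _ =
        pairwise-sums-zero y₀₁₂ y₀₂₁ y₁₀₂ y₀₁₂+y₀₂₁ y₀₂₁+y₁₀₂ y₀₁₂+y₁₀₂
      on-fan 0F 1F (suc (suc (suc i))) _ = tail-0 i
      on-fan 0F 2F 1F _ =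
        pairwise-sums-zero y₀₂₁ y₁₀₂ y₀₁₂ y₀₂₁+y₁₀₂ (trans (ℚ.+-comm y₁₀₂ y₀₁₂) y₀₁₂+y₁₀₂)
                           (trans (ℚ.+-comm y₀₂₁ y₀₁₂) y₀₁₂+y₀₂₁)
      on-fan 1F 0F 2F _ =
        pairwise-sums-zero y₁₀₂ y₀₁₂ y₀₂₁ (trans (ℚ.+-comm y₁₀₂ y₀₁₂) y₀₁₂+y₁₀₂) y₀₁₂+y₀₂₁
                           (trans (ℚ.+-comm y₁₀₂ y₀₂₁) y₀₂₁+y₁₀₂)
      on-fan 0F 0F _ ()
      on-fan 0F 1F 0F ()
      on-fan 0F 1F 1F ()
      on-fan 0F 2F 0F ()
      on-fan 0F 2F (suc (suc _)) ()
      on-fan 0F (suc (suc (suc _))) _ ()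
      on-fan 1F 0F 0F ()
      on-fan 1F 0F 1F ()
      on-fan 1F 0F (suc (suc (suc _))) ()
      on-fan 1F (suc _) _ ()
      on-fan (suc (suc _)) _ _ ()

    fanLoad-zero : ∀ y → (∀ b c d → y b c d ≡ 0ℚ) → ∀ a b → fanLoad y a b ≡ 0ℚ
    fanLoad-zero y y≡0 a b = sum-zero k λ b′ → sum-zero k λ c → sum-zero k λ d →
      trans (cong (if canonical (0F , suc b′ , suc c , suc d) then_else 0ℚ)
                  (trans (cong (incidence a b (0F , suc b′ , suc c , suc d) *_) (y≡0 b′ c d))
                         (ℚ.*-zeroʳ (incidence a b (0F , suc b′ , suc c , suc d)))))
            (if-eta (canonical (0F , suc b′ , suc c , suc d)))

    basic′ : Quad K → Bool
    basic′ = extend false fan basic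

    count-basic′ : countCycles K basic′ ≡ K C 2
    count-basic′ = countCycles-extend m basic′ (λ _ _ _ → refl) count-basic

    -- The fan takes the loads on the spokes {0 , v}; the old basis takes what is left on the other edges.
    solve′ : (Fin K → Fin K → ℚ) → Quad K → ℚ
    solve′ w = extend 0ℚ y (solve (λ a b → w (suc a) (suc b) - fanLoad y (suc a) (suc b)))
      where
      y = fanSolve (λ j → w 0F (suc j))

    solve′-supported : ∀ w → SupportedOn basic′ (solve′ w)
    solve′-supported w = extend-supported (fanSolve-supported _) (solve-supported _)

    M′-solve′ : ∀ w a b → (a <F b) ≡ true → M′ K (solve′ w) a b ≡ w a b
    M′-solve′ w 0F (suc j) _ = trans (M′-suc-0 (solve′ w) j) (fanLoad-fanSolve (λ j → w 0F (suc j)) j)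
    M′-solve′ w (suc a) (suc b) a<b = begin
        M′ K (solve′ w) (suc a) (suc b)
      ≡⟨ M′-suc (solve′ w) (suc a) (suc b) ⟩
        fanLoad y (suc a) (suc b) + M′ k (solve w′) a b
      ≡⟨ cong (fanLoad y (suc a) (suc b) +_) (M′-solve w′ a b a<b) ⟩
        fanLoad y (suc a) (suc b) + (w (suc a) (suc b) - fanLoad y (suc a) (suc b))
      ≡⟨ cancel (fanLoad y (suc a) (suc b)) (w (suc a) (suc b)) ⟩
        w (suc a) (suc b)
      ∎
      where
      y = fanSolve (λ j → w 0F (suc j))
      w′ = λ a b → w (suc a) (suc b) - fanLoad y (suc a) (suc b)
      cancel : ∀ x z → x + (z - x) ≡ z
      cancel = solve-∀ ring

    kernel-trivial′ : ∀ f → SupportedOn basic′ f → InKernel′ K f → ∀ q → f q ≡ 0ℚ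
    kernel-trivial′ f f-basic f-ker = extend-vanishing f f-basic y≡0 old≡0
      where
      y≡0 : ∀ b c d → through0 f b c d ≡ 0ℚ
      y≡0 = fan-injective (through0 f) (λ b c d → f-basic (0F , suc b , suc c , suc d))
                          (λ j → trans (sym (M′-suc-0 f j)) (f-ker 0F (suc j) refl))
      old≡0 : ∀ q → f (shift q) ≡ 0ℚ
      old≡0 = kernel-trivial (f ∘ shift) (f-basic ∘ shift) λ a b a<b → begin
        M′ k (f ∘ shift) a b
          ≡⟨ ℚ.+-identityˡ _ ⟨
        0ℚ + M′ k (f ∘ shift) a b
          ≡⟨ cong (_+ M′ k (f ∘ shift) a b) (fanLoad-zero (through0 f) y≡0 (suc a) (suc b)) ⟨
        fanLoad (through0 f) (suc a) (suc b) + M′ k (f ∘ shift) a b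
          ≡⟨ M′-suc f (suc a) (suc b) ⟨
        M′ K f (suc a) (suc b)
          ≡⟨ f-ker (suc a) (suc b) a<b ⟩
        0ℚ
          ∎

    extended : CycleBasis K
    extended = record
      { basic = basic′ ; count-basic = count-basic′ ; solve = solve′ ; solve-supported = solve′-supported
      ; M′-solve = M′-solve′ ; kernel-trivial = kernel-trivial′ }

  -- A cycle basis of K₅

  basis₅ : Fin 10 → Quad 5
  basis₅ 0F = 0F , 1F , 2F , 3F
  basis₅ 1F = 0F , 1F , 2F , 4F
  basis₅ 2F = 0F , 1F , 3F , 2F
  basis₅ 3F = 0F , 1F , 3F , 4F
  basis₅ 4F = 0F , 1F , 4F , 2F
  basis₅ 5F = 0F , 2F , 1F , 3F
  basis₅ 6F = 0F , 2F , 1F , 4F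
  basis₅ 7F = 0F , 2F , 3F , 4F
  basis₅ 8F = 0F , 3F , 1F , 4F
  basis₅ 9F = 1F , 2F , 4F , 3F

  edge₅ : Fin 10 → Fin 5 × Fin 5
  edge₅ 0F = 0F , 1F
  edge₅ 1F = 0F , 2F
  edge₅ 2F = 0F , 3F
  edge₅ 3F = 0F , 4F
  edge₅ 4F = 1F , 2F
  edge₅ 5F = 1F , 3F
  edge₅ 6F = 1F , 4F
  edge₅ 7F = 2F , 3F
  edge₅ 8F = 2F , 4F
  edge₅ 9F = 3F , 4F

  -- only meaningful for a < b
  edgeIndex₅ : Fin 5 → Fin 5 → Fin 10
  edgeIndex₅ 0F 2F = 1F
  edgeIndex₅ 0F 3F = 2F
  edgeIndex₅ 0F 4F = 3F
  edgeIndex₅ 1F 2F = 4F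
  edgeIndex₅ 1F 3F = 5F
  edgeIndex₅ 1F 4F = 6F
  edgeIndex₅ 2F 3F = 7F
  edgeIndex₅ 2F 4F = 8F
  edgeIndex₅ 3F 4F = 9F
  edgeIndex₅ _ _ = 0F

  ¼ -¼ : ℚ
  ¼ = ½ * ½
  -¼ = - ¼

  block₅ : Fin 10 → Fin 10 → ℚ
  block₅ e t = uncurry incidence (edge₅ e) (basis₅ t)

  -- the inverse of block₅ (row t, column e)
  inverse₅ : Fin 10 → Fin 10 → ℚ
  inverse₅ t e = Vec.lookup (Vec.lookup rows t) e
    where
    rows : Vec (Vec ℚ 10) 10
    rows = ( ¼ ∷ -¼ ∷  ¼ ∷ -¼ ∷  ¼ ∷ -¼ ∷  ¼ ∷  ¼ ∷ -¼ ∷  ¼ ∷ [])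
         ∷ (0ℚ ∷ 0ℚ ∷ 0ℚ ∷  ½ ∷ 0ℚ ∷ 0ℚ ∷ -½ ∷ 0ℚ ∷  ½ ∷ -½ ∷ [])
         ∷ (0ℚ ∷ 0ℚ ∷ -½ ∷ 0ℚ ∷ 0ℚ ∷  ½ ∷ 0ℚ ∷  ½ ∷ 0ℚ ∷ -½ ∷ [])
         ∷ ( ½ ∷ 0ℚ ∷ 0ℚ ∷ 0ℚ ∷ 0ℚ ∷ 0ℚ ∷ 0ℚ ∷ -½ ∷ -½ ∷  ½ ∷ [])
         ∷ ( ¼ ∷  ¼ ∷  ¼ ∷ -¼ ∷ -¼ ∷ -¼ ∷  ¼ ∷ -¼ ∷  ¼ ∷  ¼ ∷ [])
         ∷ (0ℚ ∷  ½ ∷  ½ ∷ 0ℚ ∷ 0ℚ ∷ 0ℚ ∷ -½ ∷ -½ ∷ 0ℚ ∷ 0ℚ ∷ [])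
         ∷ (0ℚ ∷ 0ℚ ∷ -½ ∷ 0ℚ ∷  ½ ∷ 0ℚ ∷  ½ ∷ 0ℚ ∷ -½ ∷ 0ℚ ∷ [])
         ∷ (-¼ ∷  ¼ ∷  ¼ ∷  ¼ ∷ -¼ ∷ -¼ ∷ -¼ ∷  ¼ ∷  ¼ ∷  ¼ ∷ [])
         ∷ (-¼ ∷ -¼ ∷  ¼ ∷  ¼ ∷ -¼ ∷  ¼ ∷  ¼ ∷  ¼ ∷  ¼ ∷ -¼ ∷ [])
         ∷ (-¼ ∷ -¼ ∷ -¼ ∷ -¼ ∷  ¼ ∷  ¼ ∷  ¼ ∷  ¼ ∷  ¼ ∷  ¼ ∷ [])
         ∷ []

  _≟Q_ : (q q′ : Quad 5) → Dec (q ≡ q′)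
  _≟Q_ = ≡-dec Fin._≟_ (≡-dec Fin._≟_ (≡-dec Fin._≟_ Fin._≟_))

  basis₅-canonical : ∀ t → canonical (basis₅ t) ≡ true
  basis₅-canonical = toWitness {a? = Fin.all? λ t → canonical (basis₅ t) Bool.≟ true} _

  basis₅-=Q : ∀ s t → (basis₅ s =Q basis₅ t) ≡ (t =F s)
  basis₅-=Q = toWitness {a? = Fin.all? λ s → Fin.all? λ t → (basis₅ s =Q basis₅ t) Bool.≟ (t =F s)} _

  edge₅-edgeIndex₅ : ∀ a b → (a <F b) ≡ true → edge₅ (edgeIndex₅ a b) ≡ (a , b)
  edge₅-edgeIndex₅ = toWitness {a? = Fin.all? λ a → Fin.all? λ b →
    ((a <F b) Bool.≟ true) →-dec ≡-dec Fin._≟_ Fin._≟_ (edge₅ (edgeIndex₅ a b)) (a , b)} _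

  edge₅-ordered : ∀ e → (proj₁ (edge₅ e) <F proj₂ (edge₅ e)) ≡ true
  edge₅-ordered = toWitness {a? = Fin.all? λ e → (proj₁ (edge₅ e) <F proj₂ (edge₅ e)) Bool.≟ true} _

  inverse₅-right : ∀ a b → (a <F b) ≡ true → ∀ e →
                   ∑[ t < 10 ] (inverse₅ t e * incidence a b (basis₅ t)) ≡ δ e (edgeIndex₅ a b)
  inverse₅-right = toWitness {a? = Fin.all? λ a → Fin.all? λ b → ((a <F b) Bool.≟ true) →-dec Fin.all? λ e →
    ∑[ t < 10 ] (inverse₅ t e * incidence a b (basis₅ t)) ℚ.≟ δ e (edgeIndex₅ a b)} _

  inverse₅-left : ∀ s t → ∑[ e < 10 ] (block₅ e t * inverse₅ s e) ≡ δ t s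
  inverse₅-left = toWitness {a? = Fin.all? λ s → Fin.all? λ t → ∑[ e < 10 ] (block₅ e t * inverse₅ s e) ℚ.≟ δ t s} _

  basic₅ : Quad 5 → Bool
  basic₅ q = does (Fin.any? λ t → q ≟Q basis₅ t)

  basic₅-false : ∀ q → basic₅ q ≡ false → ∀ t → q ≢ basis₅ t
  basic₅-false q off t q≡ = contradiction (trans (sym off) (dec-true (Fin.any? λ t → q ≟Q basis₅ t) (t , q≡))) λ ()

  M′-sparse-basis₅ : ∀ c a b → M′ 5 (sparse basis₅ c) a b ≡ ∑[ t < 10 ] (incidence a b (basis₅ t) * c t)
  M′-sparse-basis₅ c a b = trans (M′-sparse basis₅ c a b)
    (sum-cong-≗ λ t → cong (if_then incidence a b (basis₅ t) * c t else 0ℚ) (basis₅-canonical t))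

  edgeValue : (Fin 5 → Fin 5 → ℚ) → Fin 10 → ℚ
  edgeValue w e = uncurry w (edge₅ e)

  coefficients₅ : (Fin 5 → Fin 5 → ℚ) → Fin 10 → ℚ
  coefficients₅ w t = ∑[ e < 10 ] (inverse₅ t e * edgeValue w e)

  solve₅ : (Fin 5 → Fin 5 → ℚ) → Quad 5 → ℚ
  solve₅ w = sparse basis₅ (coefficients₅ w)

  M′-solve₅ : ∀ w a b → (a <F b) ≡ true → M′ 5 (solve₅ w) a b ≡ w a b
  M′-solve₅ w a b a<b = begin
    M′ 5 (solve₅ w) a b
      ≡⟨ M′-sparse-basis₅ (coefficients₅ w) a b ⟩
    ∑[ t < 10 ] (incidence a b (basis₅ t) * ∑[ e < 10 ] (inverse₅ t e * edgeValue w e))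
      ≡⟨ ∑-*-∑ (λ t → incidence a b (basis₅ t)) inverse₅ (edgeValue w) ⟩
    ∑[ e < 10 ] ((∑[ t < 10 ] (inverse₅ t e * incidence a b (basis₅ t))) * edgeValue w e)
      ≡⟨ sum-cong-≗ (λ e → cong (_* edgeValue w e) (inverse₅-right a b a<b e)) ⟩
    ∑[ e < 10 ] (δ e (edgeIndex₅ a b) * edgeValue w e)
      ≡⟨ sum-δ-* (edgeIndex₅ a b) (edgeValue w) ⟩
    edgeValue w (edgeIndex₅ a b)
      ≡⟨ cong (uncurry w) (edge₅-edgeIndex₅ a b a<b) ⟩
    w a b
      ∎

  kernel-trivial₅ : ∀ f → SupportedOn basic₅ f → InKernel′ 5 f → ∀ q → f q ≡ 0ℚ
  kernel-trivial₅ f f-basic f-ker q = trans (f-sparse q) (sparse-x≡0 q)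
    where
    x : Fin 10 → ℚ
    x = f ∘ basis₅
    f-sparse : ∀ q → f q ≡ sparse basis₅ x q
    f-sparse q with Fin.any? (λ t → q ≟Q basis₅ t)
    ... | yes (t , refl) = sym (sparse-at basis₅ basis₅-=Q x t)
    ... | no q∉ = trans (f-basic q (dec-false (Fin.any? λ t → q ≟Q basis₅ t) q∉))
                        (sym (sparse-outside basis₅ x q λ t q≡ → q∉ (t , q≡)))
    x-ker : ∀ e → ∑[ t < 10 ] (block₅ e t * x t) ≡ 0ℚ
    x-ker e = begin
      ∑[ t < 10 ] (block₅ e t * x t)      ≡⟨ M′-sparse-basis₅ x a b ⟨
      M′ 5 (sparse basis₅ x) a b          ≡⟨ M′-cong f-sparse a b ⟨
      M′ 5 f a b                          ≡⟨ f-ker a b (edge₅-ordered e) ⟩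
      0ℚ                                  ∎
      where
      a = proj₁ (edge₅ e)
      b = proj₂ (edge₅ e)
    x≡0 : ∀ s → x s ≡ 0ℚ
    x≡0 s = begin
      x s
        ≡⟨ sum-δ-* s x ⟨
      ∑[ t < 10 ] (δ t s * x t)
        ≡⟨ sum-cong-≗ (λ t → cong (_* x t) (inverse₅-left s t)) ⟨
      ∑[ t < 10 ] ((∑[ e < 10 ] (block₅ e t * inverse₅ s e)) * x t)
        ≡⟨ ∑-*-∑ (inverse₅ s) block₅ x ⟨
      ∑[ e < 10 ] (inverse₅ s e * ∑[ t < 10 ] (block₅ e t * x t))
        ≡⟨ sum-zero 10 (λ e → trans (cong (inverse₅ s e *_) (x-ker e)) (ℚ.*-zeroʳ (inverse₅ s e))) ⟩
      0ℚ
        ∎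
    sparse-x≡0 : ∀ q → sparse basis₅ x q ≡ 0ℚ
    sparse-x≡0 q = sum-zero 10 λ t → trans (cong (if q =Q basis₅ t then_else 0ℚ) (x≡0 t)) (if-eta (q =Q basis₅ t))

  K₅ : CycleBasis 5
  K₅ = record
    { basic = basic₅
    ; count-basic = refl
    ; solve = solve₅
    ; solve-supported = λ w q off → sparse-outside basis₅ (coefficients₅ w) q (basic₅-false q off)
    ; M′-solve = M′-solve₅
    ; kernel-trivial = kernel-trivial₅
    }

  -- From a cycle basis to a basis of the kernel

  module KernelBasis (n : ℕ) (B : CycleBasis n) where

    open CycleBasis B

    N : ℕ
    N = numCycles n

    row : Fin n → Fin n → Fin N → ℚ
    row a b i = M n a b i

    row·cycle : ∀ f a b → row a b · (f ∘ cycle n) ≡ M′ n f a b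
    row·cycle f a b = sum-cycles n (λ q → incidence a b q * f q)

    open Counting.Unmarked (unmarked (basic ∘ cycle n))

    column : Fin N → Fin n → Fin n → ℚ
    column j a b = M n a b j

    kernelVector : Fin size → Fin N → ℚ
    kernelVector κ i = δ i (index κ) - solve (column (index κ)) (cycle n i)

    kernelVector-ker : ∀ κ a b → (a <F b) ≡ true → row a b · kernelVector κ ≡ 0ℚ
    kernelVector-ker κ a b a<b = begin
      row a b · kernelVector κ
        ≡⟨ ·-sub (row a b) (λ i → δ i (index κ)) (solve (column (index κ)) ∘ cycle n) ⟩
      row a b · (λ i → δ i (index κ)) - row a b · (solve (column (index κ)) ∘ cycle n)
        ≡⟨ cong₂ _-_ (·-δ (row a b) (index κ)) (trans (row·cycle (solve (column (index κ))) a b) (M′-solve _ a b a<b)) ⟩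
      M n a b (index κ) - M n a b (index κ)
        ≡⟨ ℚ.+-inverseʳ (M n a b (index κ)) ⟩
      0ℚ
        ∎

    kernelVector-at : ∀ κ κ′ → kernelVector κ′ (index κ) ≡ δ κ′ κ
    kernelVector-at κ κ′ = begin
      δ (index κ) (index κ′) - solve (column (index κ′)) (cycle n (index κ))
        ≡⟨ cong (λ z → δ (index κ) (index κ′) - z) (solve-supported (column (index κ′)) _ (index-unmarked κ)) ⟩
      δ (index κ) (index κ′) - 0ℚ
        ≡⟨ ℚ.+-identityʳ _ ⟩
      δ (index κ) (index κ′)
        ≡⟨ cong (if_then 1ℚ else 0ℚ) (trans (index-=F κ κ′) (=F-sym κ κ′)) ⟩
      δ κ′ κ
        ∎

    lincomb-at : ∀ (α : Fin size → ℚ) κ → lincomb α kernelVector (index κ) ≡ α κ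
    lincomb-at α κ = begin
      ∑ size (λ κ′ → α κ′ * kernelVector κ′ (index κ))
        ≡⟨ ∑≡sum size _ ⟩
      ∑[ κ′ < size ] (α κ′ * kernelVector κ′ (index κ))
        ≡⟨ sum-cong-≗ (λ κ′ → trans (cong (α κ′ *_) (kernelVector-at κ κ′)) (ℚ.*-comm (α κ′) (δ κ′ κ))) ⟩
      ∑[ κ′ < size ] (δ κ′ κ * α κ′)
        ≡⟨ sum-δ-* κ α ⟩
      α κ
        ∎

    independent : LinIndep kernelVector
    independent α α-zero κ = trans (sym (lincomb-at α κ)) (α-zero (index κ))

    -- y = x − lincomb α kernelVector lies in the kernel and vanishes off the basic columns, so it is 0.
    spanning : ∀ x → InKernel n x → ∃ λ α → ∀ j → x j ≡ lincomb α kernelVector j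
    spanning x x-ker = α , λ j → x≡ j
      where
      α : Fin size → ℚ
      α κ = x (index κ)
      y : Fin N → ℚ
      y j = x j - lincomb α kernelVector j
      y-ker : ∀ a b → (a <F b) ≡ true → row a b · y ≡ 0ℚ
      y-ker a b a<b = begin
        row a b · y
          ≡⟨ ·-sub (row a b) x (lincomb α kernelVector) ⟩
        row a b · x - row a b · lincomb α kernelVector
          ≡⟨ cong₂ _-_ (trans (sym (∑≡sum N _)) (x-ker a b a<b))
                       (·-lincomb (row a b) α kernelVector λ κ → kernelVector-ker κ a b a<b) ⟩
        0ℚ - 0ℚ
          ≡⟨⟩
        0ℚ
          ∎
      y-basic : ∀ j → basic (cycle n j) ≡ false → y j ≡ 0ℚ
      y-basic j off with index-onto j off
      ... | κ , refl = trans (cong (λ z → x (index κ) - z) (lincomb-at α κ)) (ℚ.+-inverseʳ (x (index κ)))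
      f : Quad n → ℚ
      f = sparse (cycle n) y
      f-basic : SupportedOn basic f
      f-basic q off = sum-zero N λ i → on i
        where
        on : ∀ i → (if q =Q cycle n i then y i else 0ℚ) ≡ 0ℚ
        on i with q =Q cycle n i in q=i
        ... | false = refl
        ... | true = y-basic i (subst (λ q → basic q ≡ false) (=Q⇒≡ q=i) off)
      f-ker : InKernel′ n f
      f-ker a b a<b = begin
        M′ n f a b
          ≡⟨ M′-sparse (cycle n) y a b ⟩
        ∑[ i < N ] (if canonical (cycle n i) then incidence a b (cycle n i) * y i else 0ℚ)
          ≡⟨ sum-cong-≗ (λ i → cong (if_then incidence a b (cycle n i) * y i else 0ℚ) (canonical-cycle n i)) ⟩
        row a b · y
          ≡⟨ y-ker a b a<b ⟩
        0ℚ ∎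
      y≡0 : ∀ j → y j ≡ 0ℚ
      y≡0 j = trans (sym (sparse-at (cycle n) (λ s t → trans (cycle-=Q n s t) (=F-sym s t)) y j))
                    (kernel-trivial f f-basic f-ker (cycle n j))
      x≡ : ∀ j → x j ≡ lincomb α kernelVector j
      x≡ j = trans (unsplit (x j) (lincomb α kernelVector j))
                   (trans (cong (_+ lincomb α kernelVector j) (y≡0 j)) (ℚ.+-identityˡ _))
        where
        unsplit : ∀ a b → a ≡ (a - b) + b
        unsplit = solve-∀ ring

    kernelDim : KernelDim n size
    kernelDim =
      ( kernelVector
      , (λ κ a b a<b → trans (∑≡sum N (λ i → M n a b i * kernelVector κ i)) (kernelVector-ker κ a b a<b))
      , independent
      , spanning
      )


open Kernel using (CycleBasis; K₅; module Extension; module KernelBasis)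
open import Data.Nat using (_≤_; _+_; _*_; _∸_)

cycleBasis : ∀ n → 5 ≤ n → CycleBasis n
cycleBasis n 5≤n = subst CycleBasis (ℕ.m+[n∸m]≡n 5≤n) (from5 (n ∸ 5))
  where
  from5 : ∀ t → CycleBasis (5 + t)
  from5 zero = K₅
  from5 (suc t) = Extension.extended (2 + t) (from5 t)

mainTheorem2 : (n : ℕ) → 5 ≤ n → KernelDim n (3 * (n C 4) ∸ (n C 2))
mainTheorem2 n 5≤n = subst (KernelDim n) (unmarked-size n basic count-basic) (KernelBasis.kernelDim n B)
  where
  B = cycleBasis n 5≤n
  open CycleBasis B
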